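{- If $P=\{\xi^{a_1}(p_1)\prec\xi^{a_2}(p_2)\prec\dots\prec\xi^{a_d}(p_d)\}$ is an admissible pinnacle set for $\mathbb{Z}_m\wr S_n$ (with $a_i\in\{0,\dots,m-1\}$, $p_i\in[n]$), then $p_i\ne p_j$ for all $i\ne j$.
   Context: Let $m,n$ be positive integers, $[n]=\{1,\dots,n\}$, $\xi=e^{2\pi i/m}$. For $0\le a\le m-1$, $x\in[n]$, $\xi^a(x)$ denotes $\xi^a\cdot x$; $\mathbb{I}_n^m=\bigcup_{a=0}^{m-1}\{\xi^a(1),\dots,\xi^a(n)\}$, totally ordered by $\xi^a(x)\prec\xi^b(y)$ iff $a>b$, or $a=b$ and $x>y$. $\mathbb{Z}_m\wr S_n$ is the group of bijections $w$ of $\mathbb{I}_n^m$ with $w(\xi^i x)=\xi^i w(x)$ for $x\in[n]$ and all $i$, written $w(n)\cdots w(1)$. $\operatorname{Pin}(w)=\{w(i):2\le i\le n-1,\ w(i+1)\prec w(i)\succ w(i-1)\}$. $P\subseteq\mathbb{I}_n^m$ is an admissible pinnacle set if $P=\operatorname{Pin}(w)$ for some $w\in\mathbb{Z}_m\wr S_n$. -}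

module Defs where

open import Data.Nat using (ℕ; NonZero; _+_)
open import Data.Nat.DivMod using (_mod_)
open import Data.Fin using (Fin; toℕ) renaming (_<_ to _<ᶠ_)
open import Data.Product using (_×_; _,_; Σ; ∃; proj₁; proj₂)
open import Data.Sum using (_⊎_)
open import Relation.Binary.PropositionalEquality using (_≡_)
open import Function.Definitions using (Bijective)
open import Function.Bundles using (_⇔_)

-- The element ξ^a(x+1) of 𝕀ₙᵐ is encoded as the pair (a , x) : Fin m × Fin n
-- (positions are 0-based: x : Fin n stands for x+1 ∈ [n]).
𝕀 : ℕ → ℕ → Set
𝕀 m n = Fin m × Fin n

_≺_ : ∀ {m n} → 𝕀 m n → 𝕀 m n → Set
(a , x) ≺ (b , y) = (b <ᶠ a) ⊎ ((a ≡ b) × (y <ᶠ x))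

rot : ∀ {m n} .{{_ : NonZero m}} → ℕ → 𝕀 m n → 𝕀 m n
rot {m} i (a , x) = ((toℕ a + i) mod m , x)

base : ∀ {m n} .{{_ : NonZero m}} → Fin n → 𝕀 m n
base {m} x = (0 mod m , x)

record IsWreath (m n : ℕ) .{{_ : NonZero m}} (w : 𝕀 m n → 𝕀 m n) : Set where
  field
    bijective : Bijective _≡_ _≡_ w
    equivariant : ∀ (i : ℕ) (x : Fin n) → w (rot i (base x)) ≡ rot i (w (base x))

-- p ∈ Pin(w): p = w(k) for some position k with 2 ≤ k ≤ n-1 and
-- w(k+1) ≺ w(k) ≻ w(k-1); here j, k, l are consecutive positions
IsPin : ∀ {m n} .{{_ : NonZero m}} → (𝕀 m n → 𝕀 m n) → 𝕀 m n → Set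
IsPin {m} {n} w p =
  Σ (Fin n) λ j → Σ (Fin n) λ k → Σ (Fin n) λ l →
    (toℕ k ≡ ℕ.suc (toℕ j)) × (toℕ l ≡ ℕ.suc (toℕ k)) ×
    (w (base k) ≡ p) × (w (base l) ≺ p) × (w (base j) ≺ p)

Admissible : (m n : ℕ) .{{_ : NonZero m}} → (𝕀 m n → Set) → Set
Admissible m n P = Σ (𝕀 m n → 𝕀 m n) λ w → IsWreath m n w × (∀ p → P p ⇔ IsPin w p)

{-# OPTIONS --safe #-}
module Submission where

-- If two pinnacles ξ^a(p) and ξ^b(p) share the letter p, write them as w(k) and w(l).
-- Equivariance gives w(ξ^(b-a) k) = ξ^(b-a) w(k) = ξ^b(p) = w(l), so by injectivity
-- ξ^(b-a) k = l; comparing letters, k = l, and the two pinnacles coincide.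

open import Defs
open import Data.Nat using (ℕ; NonZero; _≤_; _+_; _∸_)
open import Data.Nat.Properties using (+-assoc; +-comm; m+[n∸m]≡n; <⇒≤)
open import Data.Nat.DivMod using (_%_; _mod_; [m+n]%n≡m%n; m<n⇒m%n≡m)
open import Data.Fin using (Fin; toℕ)
open import Data.Fin.Properties using (toℕ-fromℕ<; toℕ-injective; toℕ<n)
open import Data.Product using (Σ; _,_; proj₁; proj₂)
open import Function.Bundles using (Equivalence)
open import Relation.Binary.PropositionalEquality
  using (_≡_; refl; sym; cong; module ≡-Reasoning)
open import Relation.Nullary using (¬_)

rotation-between : ∀ {m} → Fin m → Fin m → ℕ
rotation-between {m} a b = (m ∸ toℕ a) + toℕ b

rot-rotation-between : ∀ {m n} .{{_ : NonZero m}} (a b : Fin m) (x : Fin n) →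
  rot (rotation-between a b) (a , x) ≡ (b , x)
rot-rotation-between {m} a b x = cong (_, x) (toℕ-injective (begin
  toℕ ((toℕ a + ((m ∸ toℕ a) + toℕ b)) mod m) ≡⟨ toℕ-fromℕ< _ ⟩
  (toℕ a + ((m ∸ toℕ a) + toℕ b)) % m         ≡⟨ cong (_% m) (sym (+-assoc (toℕ a) _ _)) ⟩
  (toℕ a + (m ∸ toℕ a) + toℕ b) % m           ≡⟨ cong (λ k → (k + toℕ b) % m) (m+[n∸m]≡n (<⇒≤ (toℕ<n a))) ⟩
  (m + toℕ b) % m                             ≡⟨ cong (_% m) (+-comm m (toℕ b)) ⟩
  (toℕ b + m) % m                             ≡⟨ [m+n]%n≡m%n (toℕ b) m ⟩
  toℕ b % m                                   ≡⟨ m<n⇒m%n≡m (toℕ<n b) ⟩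
  toℕ b                                       ∎))
  where open ≡-Reasoning

pinnacle-position : ∀ {m n} .{{_ : NonZero m}} (w : 𝕀 m n → 𝕀 m n) {p : 𝕀 m n} →
  IsPin w p → Σ (Fin n) λ k → w (base k) ≡ p
pinnacle-position _ (_ , k , _ , _ , _ , wk≡p , _) = k , wk≡p

module _ {m n : ℕ} .{{_ : NonZero m}} {w : 𝕀 m n → 𝕀 m n} (W : IsWreath m n w) where
  open IsWreath W

  same-letter⇒same-position : ∀ {k l : Fin n} {a b : Fin m} {x : Fin n} →
    w (base k) ≡ (a , x) → w (base l) ≡ (b , x) → k ≡ l
  same-letter⇒same-position {k} {l} {a} {b} {x} wk≡ax wl≡bx =
    cong proj₂ (proj₁ bijective (begin
      w (rot i (base k)) ≡⟨ equivariant i k ⟩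
      rot i (w (base k)) ≡⟨ cong (rot i) wk≡ax ⟩
      rot i (a , x)      ≡⟨ rot-rotation-between a b x ⟩
      (b , x)            ≡⟨ sym wl≡bx ⟩
      w (base l)         ∎))
    where
    open ≡-Reasoning
    i : ℕ
    i = rotation-between a b

mainTheorem7 : (m n : ℕ) .{{_ : NonZero m}} → 1 ≤ n → (P : 𝕀 m n → Set) →
    Admissible m n P →
    ∀ (e₁ e₂ : 𝕀 m n) → P e₁ → P e₂ → ¬ (e₁ ≡ e₂) → ¬ (proj₂ e₁ ≡ proj₂ e₂)
mainTheorem7 m n _ P (w , W , P⇔Pin) (a , x) (b , .x) Pe₁ Pe₂ e₁≢e₂ refl
  with pinnacle-position w (Equivalence.to (P⇔Pin (a , x)) Pe₁)
     | pinnacle-position w (Equivalence.to (P⇔Pin (b , x)) Pe₂)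
... | k , wk≡e₁ | l , wl≡e₂ = e₁≢e₂ (begin
  (a , x)    ≡⟨ sym wk≡e₁ ⟩
  w (base k) ≡⟨ cong (λ j → w (base j)) (same-letter⇒same-position W wk≡e₁ wl≡e₂) ⟩
  w (base l) ≡⟨ wl≡e₂ ⟩
  (b , x)    ∎)
  where open ≡-Reasoning
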